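{- Let $\mathcal{C}$ be the category whose objects are the finite types and whose morphisms $\alpha\to\beta$ are equivalence classes of closed terms $t:\alpha\to\beta$, where $t,t'$ are equivalent iff $\mathsf{H}\text{ - }\mathsf{HA}^\omega\vdash t=_{\alpha\to\beta}t'$, with identity $\lambda x.x$ and composition of $s:\alpha\to\beta$ and $t:\beta\to\gamma$ given by $\lambda x.t(sx)$; and let $\mathcal{S}$ be the subcategory with the same objects whose morphisms are the strong morphisms of $\mathcal{C}$. Then for all finite types $\alpha,\beta$, the type $\alpha\times\beta$ together with $\mathsf{fst}:\alpha\times\beta\to\alpha$ and $\mathsf{snd}:\alpha\times\beta\to\beta$ is a categorical product of $\alpha$ and $\beta$ both in $\mathcal{C}$ and in $\mathcal{S}$.
   Context: Finite types are generated by: $0$ is a type; if $\sigma,\tau$ are types, so are $\sigma\times\tau$ and $\sigma\to\tau$. $\mathsf{HA}^\omega$ is the many-sorted intuitionistic first-order theory whose sorts are the finite types. Its terms are built from variables and, for all types $\rho,\sigma,\tau$, the constants $\mathsf{k}:\rho\to\sigma\to\rho$, $\mathsf{s}:(\rho\to\sigma\to\tau)\to(\rho\to\sigma)\to(\rho\to\tau)$, $\mathsf{pair}:\sigma\to\tau\to\sigma\times\tau$, $\mathsf{fst}:\sigma\times\tau\to\sigma$, $\mathsf{snd}:\sigma\times\tau\to\tau$, $0:0$, $S:0\to0$, $\mathsf{R}:\sigma\to(0\to\sigma\to\sigma)\to0\to\sigma$, by application (associating to the left). Atomic formulas are $\bot$ and $s\equiv_\sigma t$. Axioms: $\equiv_\sigma$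 is an equivalence relation; $x\equiv x'\to y\equiv y'\to xy\equiv x'y'$; $\mathsf{k}xy\equiv x$; $\mathsf{s}xyz\equiv xz(yz)$; $\mathsf{fst}(\mathsf{pair}\,xy)\equiv x$; $\mathsf{snd}(\mathsf{pair}\,xy)\equiv y$; $\mathsf{R}xy0\equiv x$; $\mathsf{R}xy(Sm)\equiv ym(\mathsf{R}xym)$; $Sx\equiv_0Sy\to x\equiv_0y$; $\neg(Sx\equiv_00)$; induction for all formulas. Surjective pairing is not assumed. The combinatory abstraction $\lambda x.t$ is defined by $\lambda x.x:=\mathsf{s}\mathsf{k}\mathsf{k}$, $\lambda x.y:=\mathsf{k}y$ for a variable $y\neq x$, $\lambda x.c:=\mathsf{k}c$ for a constant $c$, $\lambda x.st:=\mathsf{s}(\lambda x.s)(\lambda x.t)$. $\mathsf{H}\text{ - }\mathsf{HA}^\omega$ extends the language with, for each type $\sigma$, a unary predicate $\mathrm{Ext}_\sigma$ and a binary predicate $=_\sigma$; $\forall^{\mathrm{Ext}}x:\sigma.\psi$ abbreviates $\forall x:\sigma(\mathrm{Ext}_\sigma(x)\to\psi)$. Its axioms are those of $\mathsf{HA}^\omega$, induction for all formulas of the extended language, and for all $\sigma,\tau$: $x=_0y\leftrightarrow x\equiv_0y$; $\forall x:0\,\mathrm{Ext}_0(x)$; $x=_{\sigma\times\tau}y\leftrightarrow(\mathsf{fst}\,x=_\sigma\mathsf{fst}\,y\wedge\mathsf{snd}\,x=_\tau\mathsf{snd}\,y)$; $\mathrm{Ext}_{\sigma\times\tau}(x)\leftrightarrow(\mathrm{Ext}_\sigma(\mathsf{fst}\,x)\wedge\mathrm{Ext}_\tau(\mathsf{snd}\,x))$;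 $f=_{\sigma\to\tau}g\leftrightarrow\forall^{\mathrm{Ext}}x:\sigma.fx=_\tau gx$; $\mathrm{Ext}_{\sigma\to\tau}(f)\to\mathrm{Ext}_\sigma(x)\to\mathrm{Ext}_\tau(fx)$; $x\equiv_\sigma y\to\mathrm{Ext}_\sigma(x)\to\mathrm{Ext}_\sigma(y)$; $\mathrm{Ext}(c)$ for each constant $c$. A closed term $t:\alpha\to\beta$ (or the morphism it represents) is strong if $\mathsf{H}\text{ - }\mathsf{HA}^\omega\vdash\forall x,y:\alpha(\mathrm{Ext}_\alpha(x)\to\mathrm{Ext}_\alpha(y)\to x=_\alpha y\to tx=_\beta ty)$. -}

module Defs where

open import Data.List using (List; []; _∷_; map)
open import Data.List.Membership.Propositional using (_∈_)
open import Data.Product using (Σ; _×_; _,_)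
open import Data.Unit using (⊤)

infixr 7 _⊗_
infixr 6 _⇒_

data Ty : Set where
  o   : Ty
  _⊗_ : Ty → Ty → Ty
  _⇒_ : Ty → Ty → Ty

Ctx : Set
Ctx = List Ty

infix 4 _∋_
data _∋_ : Ctx → Ty → Set where
  here  : ∀ {Γ σ} → (σ ∷ Γ) ∋ σ
  there : ∀ {Γ σ τ} → Γ ∋ σ → (τ ∷ Γ) ∋ σ

data Const : Ty → Set where
  k    : ∀ {ρ σ} → Const (ρ ⇒ σ ⇒ ρ)
  s    : ∀ {ρ σ τ} → Const ((ρ ⇒ σ ⇒ τ) ⇒ (ρ ⇒ σ) ⇒ (ρ ⇒ τ))
  pair : ∀ {σ τ} → Const (σ ⇒ τ ⇒ σ ⊗ τ)
  fst  : ∀ {σ τ} → Const (σ ⊗ τ ⇒ σ)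
  snd  : ∀ {σ τ} → Const (σ ⊗ τ ⇒ τ)
  zer  : Const o
  suc  : Const (o ⇒ o)
  rec  : ∀ {σ} → Const (σ ⇒ (o ⇒ σ ⇒ σ) ⇒ o ⇒ σ)

infixl 9 _·_
data Tm (Γ : Ctx) : Ty → Set where
  var : ∀ {σ} → Γ ∋ σ → Tm Γ σ
  con : ∀ {σ} → Const σ → Tm Γ σ
  _·_ : ∀ {σ τ} → Tm Γ (σ ⇒ τ) → Tm Γ σ → Tm Γ τ

infix  8 _≐_ _≈ₑ_
infixr 5 _∧'_
infixr 4 _∨'_
infixr 3 _⇒'_

data Fm (Γ : Ctx) : Set where
  bot   : Fm Γ
  _≐_   : ∀ {σ} → Tm Γ σ → Tm Γ σ → Fm Γ      -- intensional ≡_σ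
  Ext   : ∀ σ → Tm Γ σ → Fm Γ
  _≈ₑ_  : ∀ {σ} → Tm Γ σ → Tm Γ σ → Fm Γ      -- extensional =_σ
  _∧'_  : Fm Γ → Fm Γ → Fm Γ
  _∨'_  : Fm Γ → Fm Γ → Fm Γ
  _⇒'_  : Fm Γ → Fm Γ → Fm Γ
  ∀'    : ∀ σ → Fm (σ ∷ Γ) → Fm Γ
  ∃'    : ∀ σ → Fm (σ ∷ Γ) → Fm Γ

¬' : ∀ {Γ} → Fm Γ → Fm Γ
¬' φ = φ ⇒' bot

infix 2 _⇔'_
_⇔'_ : ∀ {Γ} → Fm Γ → Fm Γ → Fm Γ
φ ⇔' ψ = (φ ⇒' ψ) ∧' (ψ ⇒' φ)

Ren : Ctx → Ctx → Set
Ren Γ Δ = ∀ {σ} → Γ ∋ σ → Δ ∋ σ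

liftR : ∀ {Γ Δ τ} → Ren Γ Δ → Ren (τ ∷ Γ) (τ ∷ Δ)
liftR ρ here      = here
liftR ρ (there x) = there (ρ x)

renT : ∀ {Γ Δ σ} → Ren Γ Δ → Tm Γ σ → Tm Δ σ
renT ρ (var x) = var (ρ x)
renT ρ (con c) = con c
renT ρ (t · u) = renT ρ t · renT ρ u

renF : ∀ {Γ Δ} → Ren Γ Δ → Fm Γ → Fm Δ
renF ρ bot        = bot
renF ρ (t ≐ u)    = renT ρ t ≐ renT ρ u
renF ρ (Ext σ t)  = Ext σ (renT ρ t)
renF ρ (t ≈ₑ u)   = renT ρ t ≈ₑ renT ρ u
renF ρ (φ ∧' ψ)   = renF ρ φ ∧' renF ρ ψ
renF ρ (φ ∨' ψ)   = renF ρ φ ∨' renF ρ ψ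
renF ρ (φ ⇒' ψ)   = renF ρ φ ⇒' renF ρ ψ
renF ρ (∀' σ φ)   = ∀' σ (renF (liftR ρ) φ)
renF ρ (∃' σ φ)   = ∃' σ (renF (liftR ρ) φ)

wkT : ∀ {Γ σ τ} → Tm Γ σ → Tm (τ ∷ Γ) σ
wkT = renT there

wkF : ∀ {Γ τ} → Fm Γ → Fm (τ ∷ Γ)
wkF = renF there

Sub : Ctx → Ctx → Set
Sub Γ Δ = ∀ {σ} → Γ ∋ σ → Tm Δ σ

liftS : ∀ {Γ Δ τ} → Sub Γ Δ → Sub (τ ∷ Γ) (τ ∷ Δ)
liftS θ here      = var here
liftS θ (there x) = wkT (θ x)

subT : ∀ {Γ Δ σ} → Sub Γ Δ → Tm Γ σ → Tm Δ σ
subT θ (var x) = θ x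
subT θ (con c) = con c
subT θ (t · u) = subT θ t · subT θ u

subF : ∀ {Γ Δ} → Sub Γ Δ → Fm Γ → Fm Δ
subF θ bot        = bot
subF θ (t ≐ u)    = subT θ t ≐ subT θ u
subF θ (Ext σ t)  = Ext σ (subT θ t)
subF θ (t ≈ₑ u)   = subT θ t ≈ₑ subT θ u
subF θ (φ ∧' ψ)   = subF θ φ ∧' subF θ ψ
subF θ (φ ∨' ψ)   = subF θ φ ∨' subF θ ψ
subF θ (φ ⇒' ψ)   = subF θ φ ⇒' subF θ ψ
subF θ (∀' σ φ)   = ∀' σ (subF (liftS θ) φ)
subF θ (∃' σ φ)   = ∃' σ (subF (liftS θ) φ)

sub0 : ∀ {Γ σ} → Tm Γ σ → Sub (σ ∷ Γ) Γ
sub0 t here      = t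
sub0 t (there x) = var x

subSuc : ∀ {Γ} → Sub (o ∷ Γ) (o ∷ Γ)
subSuc here      = con suc · var here
subSuc (there x) = var (there x)

-- Derivability in H-HA^ω: intuitionistic many-sorted natural deduction
-- (sequents  Γ ; Δ ⊢ φ  with Γ the variable context and Δ the hypotheses),
-- plus all (instances of the) axioms of H-HA^ω.

data Pf (Γ : Ctx) (Δ : List (Fm Γ)) : Fm Γ → Set where
  hyp  : ∀ {φ} → φ ∈ Δ → Pf Γ Δ φ
  botE : ∀ {φ} → Pf Γ Δ bot → Pf Γ Δ φ
  ∧I   : ∀ {φ ψ} → Pf Γ Δ φ → Pf Γ Δ ψ → Pf Γ Δ (φ ∧' ψ)
  ∧E₁  : ∀ {φ ψ} → Pf Γ Δ (φ ∧' ψ) → Pf Γ Δ φ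
  ∧E₂  : ∀ {φ ψ} → Pf Γ Δ (φ ∧' ψ) → Pf Γ Δ ψ
  ∨I₁  : ∀ {φ ψ} → Pf Γ Δ φ → Pf Γ Δ (φ ∨' ψ)
  ∨I₂  : ∀ {φ ψ} → Pf Γ Δ ψ → Pf Γ Δ (φ ∨' ψ)
  ∨E   : ∀ {φ ψ χ} → Pf Γ Δ (φ ∨' ψ) → Pf Γ (φ ∷ Δ) χ → Pf Γ (ψ ∷ Δ) χ → Pf Γ Δ χ
  ⇒I   : ∀ {φ ψ} → Pf Γ (φ ∷ Δ) ψ → Pf Γ Δ (φ ⇒' ψ)
  ⇒E   : ∀ {φ ψ} → Pf Γ Δ (φ ⇒' ψ) → Pf Γ Δ φ → Pf Γ Δ ψ
  ∀I   : ∀ {σ φ} → Pf (σ ∷ Γ) (map wkF Δ) φ → Pf Γ Δ (∀' σ φ)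
  ∀E   : ∀ {σ φ} → Pf Γ Δ (∀' σ φ) → (t : Tm Γ σ) → Pf Γ Δ (subF (sub0 t) φ)
  ∃I   : ∀ {σ φ} → (t : Tm Γ σ) → Pf Γ Δ (subF (sub0 t) φ) → Pf Γ Δ (∃' σ φ)
  ∃E   : ∀ {σ φ ψ} → Pf Γ Δ (∃' σ φ) → Pf (σ ∷ Γ) (φ ∷ map wkF Δ) (wkF ψ) → Pf Γ Δ ψ
  -- axioms of HA^ω (schematic in the free variables, i.e. all instances)
  ≐refl  : ∀ {σ} (x : Tm Γ σ) → Pf Γ Δ (x ≐ x)
  ≐sym   : ∀ {σ} (x y : Tm Γ σ) → Pf Γ Δ (x ≐ y ⇒' y ≐ x)
  ≐trans : ∀ {σ} (x y z : Tm Γ σ) → Pf Γ Δ (x ≐ y ⇒' y ≐ z ⇒' x ≐ z)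
  ≐app   : ∀ {σ τ} (x x' : Tm Γ (σ ⇒ τ)) (y y' : Tm Γ σ) →
           Pf Γ Δ (x ≐ x' ⇒' y ≐ y' ⇒' (x · y) ≐ (x' · y'))
  ax-k    : ∀ {ρ σ} (x : Tm Γ ρ) (y : Tm Γ σ) → Pf Γ Δ ((con k · x · y) ≐ x)
  ax-s    : ∀ {ρ σ τ} (x : Tm Γ (ρ ⇒ σ ⇒ τ)) (y : Tm Γ (ρ ⇒ σ)) (z : Tm Γ ρ) →
            Pf Γ Δ ((con s · x · y · z) ≐ (x · z · (y · z)))
  ax-fst  : ∀ {σ τ} (x : Tm Γ σ) (y : Tm Γ τ) → Pf Γ Δ ((con fst · (con pair · x · y)) ≐ x)
  ax-snd  : ∀ {σ τ} (x : Tm Γ σ) (y : Tm Γ τ) → Pf Γ Δ ((con snd · (con pair · x · y)) ≐ y)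
  ax-R0   : ∀ {σ} (x : Tm Γ σ) (y : Tm Γ (o ⇒ σ ⇒ σ)) → Pf Γ Δ ((con rec · x · y · con zer) ≐ x)
  ax-RS   : ∀ {σ} (x : Tm Γ σ) (y : Tm Γ (o ⇒ σ ⇒ σ)) (m : Tm Γ o) →
            Pf Γ Δ ((con rec · x · y · (con suc · m)) ≐ (y · m · (con rec · x · y · m)))
  ax-Sinj : (x y : Tm Γ o) → Pf Γ Δ ((con suc · x) ≐ (con suc · y) ⇒' x ≐ y)
  ax-S0   : (x : Tm Γ o) → Pf Γ Δ (¬' ((con suc · x) ≐ con zer))
  ax-ind  : (φ : Fm (o ∷ Γ)) →
            Pf Γ Δ (subF (sub0 (con zer)) φ ⇒' ∀' o (φ ⇒' subF subSuc φ) ⇒' ∀' o φ)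
  ax-=0    : (x y : Tm Γ o) → Pf Γ Δ (x ≈ₑ y ⇔' x ≐ y)
  ax-Ext0  : (x : Tm Γ o) → Pf Γ Δ (Ext o x)
  ax-=×    : ∀ {σ τ} (x y : Tm Γ (σ ⊗ τ)) →
             Pf Γ Δ (x ≈ₑ y ⇔' ((con fst · x) ≈ₑ (con fst · y) ∧' (con snd · x) ≈ₑ (con snd · y)))
  ax-Ext×  : ∀ {σ τ} (x : Tm Γ (σ ⊗ τ)) →
             Pf Γ Δ (Ext (σ ⊗ τ) x ⇔' (Ext σ (con fst · x) ∧' Ext τ (con snd · x)))
  ax-=⇒    : ∀ {σ τ} (f g : Tm Γ (σ ⇒ τ)) →
             Pf Γ Δ (f ≈ₑ g ⇔' ∀' σ (Ext σ (var here) ⇒' (wkT f · var here) ≈ₑ (wkT g · var here)))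
  ax-Ext⇒  : ∀ {σ τ} (f : Tm Γ (σ ⇒ τ)) (x : Tm Γ σ) →
             Pf Γ Δ (Ext (σ ⇒ τ) f ⇒' Ext σ x ⇒' Ext τ (f · x))
  ax-Ext≐  : ∀ {σ} (x y : Tm Γ σ) → Pf Γ Δ (x ≐ y ⇒' Ext σ x ⇒' Ext σ y)
  ax-Extc  : ∀ {σ} (c : Const σ) → Pf Γ Δ (Ext σ (con c))

Thm : Fm [] → Set
Thm φ = Pf [] [] φ

-- Combinatory abstraction λx.t  (x = variable 0)

I : ∀ {Γ ρ} → Tm Γ (ρ ⇒ ρ)
I {ρ = ρ} = con (s {ρ} {ρ ⇒ ρ} {ρ}) · con k · con (k {ρ} {ρ})

lam : ∀ {Γ σ τ} → Tm (σ ∷ Γ) τ → Tm Γ (σ ⇒ τ)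
lam (var here)      = I
lam (var (there x)) = con k · var x
lam (con c)         = con k · con c
lam (t · u)         = con s · lam t · lam u

Hom : Ty → Ty → Set
Hom α β = Tm [] (α ⇒ β)

infix 4 _≈C_
_≈C_ : ∀ {α β} → Hom α β → Hom α β → Set
t ≈C t' = Thm (t ≈ₑ t')

idC : ∀ {α} → Hom α α
idC = lam (var here)

_⨾_ : ∀ {α β γ} → Hom α β → Hom β γ → Hom α γ
f ⨾ g = lam (wkT g · (wkT f · var here))

Strong : ∀ {α β} → Hom α β → Set
Strong {α} t =
  Thm (∀' α (∀' α (Ext α (var (there here)) ⇒' Ext α (var here) ⇒'
        var (there here) ≈ₑ var here ⇒'
        (wkT (wkT t) · var (there here)) ≈ₑ (wkT (wkT t) · var here))))

-- (α×β, fst, snd) is a product of α and β in the wide subcategory of C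
-- whose morphisms are those satisfying P.
record IsProductIn (P : ∀ {α β} → Hom α β → Set) (α β : Ty) : Set where
  field
    fst-in : P (con (fst {α} {β}))
    snd-in : P (con (snd {α} {β}))
    universal : ∀ γ (f : Hom γ α) (g : Hom γ β) → P f → P g →
      Σ (Hom γ (α ⊗ β)) λ h →
        P h × (h ⨾ con fst) ≈C f × (h ⨾ con snd) ≈C g ×
        (∀ (h' : Hom γ (α ⊗ β)) → P h' →
           (h' ⨾ con fst) ≈C f → (h' ⨾ con snd) ≈C g → h' ≈C h)

AllMorphisms : ∀ {α β} → Hom α β → Set
AllMorphisms _ = ⊤

IsProductC : Ty → Ty → Set
IsProductC = IsProductIn AllMorphisms

IsProductS : Ty → Ty → Set
IsProductS = IsProductIn Strong

-- Pair two morphisms by ⟨f,g⟩ := s (s (k pair) f) g, so that ⟨f,g⟩ x ≐ pair (f x) (g x).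
-- Intensional equality implies extensional equality at every type, which makes both
-- triangles commute. Uniqueness needs no surjective pairing, because =_{α×β} is
-- componentwise: if h ⨾ fst = f and h ⨾ snd = g, then h x and ⟨f,g⟩ x have extensionally
-- equal components for every extensional x. Finally fst, snd are strong by the axiom for
-- =_{α×β}, and ⟨f,g⟩ is strong whenever f and g are, again componentwise.
module Submission where

open import Defs
open import Data.Product using (_×_; _,_)
open import Data.Unit using (tt)
open import Data.List using (List; []; _∷_)
import Data.List.Relation.Unary.Any as Any
open import Relation.Binary.PropositionalEquality
  using (_≡_; refl; cong; cong₂; trans; subst; subst₂; module ≡-Reasoning)

module _ {Γ : Ctx} {Δ : List (Fm Γ)} where
  hyp₀ : ∀ {φ₀} → Pf Γ (φ₀ ∷ Δ) φ₀
  hyp₀ = hyp (Any.here refl)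

  hyp₁ : ∀ {φ₀ φ₁} → Pf Γ (φ₀ ∷ φ₁ ∷ Δ) φ₁
  hyp₁ = hyp (Any.there (Any.here refl))

  hyp₂ : ∀ {φ₀ φ₁ φ₂} → Pf Γ (φ₀ ∷ φ₁ ∷ φ₂ ∷ Δ) φ₂
  hyp₂ = hyp (Any.there (Any.there (Any.here refl)))

  hyp₃ : ∀ {φ₀ φ₁ φ₂ φ₃} → Pf Γ (φ₀ ∷ φ₁ ∷ φ₂ ∷ φ₃ ∷ Δ) φ₃
  hyp₃ = hyp (Any.there (Any.there (Any.there (Any.here refl))))

  hyp₄ : ∀ {φ₀ φ₁ φ₂ φ₃ φ₄} → Pf Γ (φ₀ ∷ φ₁ ∷ φ₂ ∷ φ₃ ∷ φ₄ ∷ Δ) φ₄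
  hyp₄ = hyp (Any.there (Any.there (Any.there (Any.there (Any.here refl)))))

v₀ : ∀ {Γ σ} → Tm (σ ∷ Γ) σ
v₀ = var here

v₁ : ∀ {Γ σ τ} → Tm (τ ∷ σ ∷ Γ) σ
v₁ = var (there here)

renT-liftR-wkT : ∀ {Γ Δ σ τ} (ρ : Ren Γ Δ) (t : Tm Γ σ) →
                 renT (liftR {τ = τ} ρ) (wkT t) ≡ wkT (renT ρ t)
renT-liftR-wkT ρ (var x) = refl
renT-liftR-wkT ρ (con c) = refl
renT-liftR-wkT ρ (t · u) = cong₂ _·_ (renT-liftR-wkT ρ t) (renT-liftR-wkT ρ u)

subT-liftS-wkT : ∀ {Γ Δ σ τ} (θ : Sub Γ Δ) (t : Tm Γ σ) →
                 subT (liftS {τ = τ} θ) (wkT t) ≡ wkT (subT θ t)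
subT-liftS-wkT θ (var x) = refl
subT-liftS-wkT θ (con c) = refl
subT-liftS-wkT θ (t · u) = cong₂ _·_ (subT-liftS-wkT θ t) (subT-liftS-wkT θ u)

subT-sub0-wkT : ∀ {Γ σ τ} (x : Tm Γ σ) (t : Tm Γ τ) → subT (sub0 x) (wkT t) ≡ t
subT-sub0-wkT x (var y) = refl
subT-sub0-wkT x (con c) = refl
subT-sub0-wkT x (t · u) = cong₂ _·_ (subT-sub0-wkT x t) (subT-sub0-wkT x u)

renT-lam : ∀ {Γ Δ σ τ} (ρ : Ren Γ Δ) (t : Tm (σ ∷ Γ) τ) →
           renT ρ (lam t) ≡ lam (renT (liftR ρ) t)
renT-lam ρ (var here)      = refl
renT-lam ρ (var (there x)) = refl
renT-lam ρ (con c)         = refl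
renT-lam ρ (t · u)         =
  cong₂ (λ a b → con s · a · b) (renT-lam ρ t) (renT-lam ρ u)

⟨_,_⟩ : ∀ {Γ γ α β} → Tm Γ (γ ⇒ α) → Tm Γ (γ ⇒ β) → Tm Γ (γ ⇒ α ⊗ β)
⟨ F , G ⟩ = con s · (con s · (con k · con pair) · F) · G

module _ {Γ : Ctx} {Δ : List (Fm Γ)} where
  ≡⇒≐ : ∀ {σ} {a b : Tm Γ σ} → a ≡ b → Pf Γ Δ (a ≐ b)
  ≡⇒≐ refl = ≐refl _

  ≐-sym : ∀ {σ} {a b : Tm Γ σ} → Pf Γ Δ (a ≐ b) → Pf Γ Δ (b ≐ a)
  ≐-sym p = ⇒E (≐sym _ _) p

  ≐-trans : ∀ {σ} {a b c : Tm Γ σ} → Pf Γ Δ (a ≐ b) → Pf Γ Δ (b ≐ c) → Pf Γ Δ (a ≐ c)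
  ≐-trans p q = ⇒E (⇒E (≐trans _ _ _) p) q

  ·-cong : ∀ {σ τ} {f f' : Tm Γ (σ ⇒ τ)} {x x' : Tm Γ σ} →
           Pf Γ Δ (f ≐ f') → Pf Γ Δ (x ≐ x') → Pf Γ Δ (f · x ≐ f' · x')
  ·-cong p q = ⇒E (⇒E (≐app _ _ _ _) p) q

  ·-congˡ : ∀ {σ τ} {f f' : Tm Γ (σ ⇒ τ)} {x : Tm Γ σ} →
            Pf Γ Δ (f ≐ f') → Pf Γ Δ (f · x ≐ f' · x)
  ·-congˡ p = ·-cong p (≐refl _)

  ·-congʳ : ∀ {σ τ} {f : Tm Γ (σ ⇒ τ)} {x x' : Tm Γ σ} →
            Pf Γ Δ (x ≐ x') → Pf Γ Δ (f · x ≐ f · x')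
  ·-congʳ p = ·-cong (≐refl _) p

  lam-β : ∀ {σ τ} (t : Tm (σ ∷ Γ) τ) (x : Tm Γ σ) →
          Pf Γ Δ (lam t · x ≐ subT (sub0 x) t)
  lam-β (var here)      x = ≐-trans (ax-s (con k) (con k) x) (ax-k x (con k · x))
  lam-β (var (there y)) x = ax-k (var y) x
  lam-β (con c)         x = ax-k (con c) x
  lam-β (t · u)         x =
    ≐-trans (ax-s (lam t) (lam u) x) (·-cong (lam-β t x) (lam-β u x))

  ⨾-β : ∀ {α β γ} (ρ : Ren [] Γ) (f : Hom α β) (g : Hom β γ) (x : Tm Γ α) →
        Pf Γ Δ (renT ρ (f ⨾ g) · x ≐ renT ρ g · (renT ρ f · x))
  ⨾-β ρ f g x =
    ≐-trans (≡⇒≐ (cong (_· x) (renT-lam ρ (wkT g · (wkT f · v₀)))))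
      (≐-trans (lam-β (renT (liftR ρ) (wkT g · (wkT f · v₀))) x)
        (≡⇒≐ (cong₂ (λ g' f' → g' · (f' · x)) (sub0-liftR-wkT g) (sub0-liftR-wkT f))))
    where
    sub0-liftR-wkT : ∀ {σ} (t : Tm [] σ) →
                     subT (sub0 x) (renT (liftR ρ) (wkT t)) ≡ renT ρ t
    sub0-liftR-wkT t =
      trans (cong (subT (sub0 x)) (renT-liftR-wkT ρ t)) (subT-sub0-wkT x (renT ρ t))

  ≈o-intro : {a b : Tm Γ o} → Pf Γ Δ (a ≐ b) → Pf Γ Δ (a ≈ₑ b)
  ≈o-intro p = ⇒E (∧E₂ (ax-=0 _ _)) p

  ≈o-elim : {a b : Tm Γ o} → Pf Γ Δ (a ≈ₑ b) → Pf Γ Δ (a ≐ b)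
  ≈o-elim p = ⇒E (∧E₁ (ax-=0 _ _)) p

  ≈⊗-intro : ∀ {σ τ} {a b : Tm Γ (σ ⊗ τ)} → Pf Γ Δ (con fst · a ≈ₑ con fst · b) →
             Pf Γ Δ (con snd · a ≈ₑ con snd · b) → Pf Γ Δ (a ≈ₑ b)
  ≈⊗-intro p q = ⇒E (∧E₂ (ax-=× _ _)) (∧I p q)

  ≈⊗-fst : ∀ {σ τ} {a b : Tm Γ (σ ⊗ τ)} →
           Pf Γ Δ (a ≈ₑ b) → Pf Γ Δ (con fst · a ≈ₑ con fst · b)
  ≈⊗-fst p = ∧E₁ (⇒E (∧E₁ (ax-=× _ _)) p)

  ≈⊗-snd : ∀ {σ τ} {a b : Tm Γ (σ ⊗ τ)} →
           Pf Γ Δ (a ≈ₑ b) → Pf Γ Δ (con snd · a ≈ₑ con snd · b)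
  ≈⊗-snd p = ∧E₂ (⇒E (∧E₁ (ax-=× _ _)) p)

  ≈⇒-intro : ∀ {σ τ} {f g : Tm Γ (σ ⇒ τ)} →
             Pf Γ Δ (∀' σ (Ext σ v₀ ⇒' wkT f · v₀ ≈ₑ wkT g · v₀)) → Pf Γ Δ (f ≈ₑ g)
  ≈⇒-intro p = ⇒E (∧E₂ (ax-=⇒ _ _)) p

  ≈-app : ∀ {σ τ} {f g : Tm Γ (σ ⇒ τ)} {x : Tm Γ σ} →
          Pf Γ Δ (f ≈ₑ g) → Pf Γ Δ (Ext σ x) → Pf Γ Δ (f · x ≈ₑ g · x)
  ≈-app {f = f} {g} {x} p e =
    subst₂ (λ f' g' → Pf Γ Δ (f' · x ≈ₑ g' · x)) (subT-sub0-wkT x f) (subT-sub0-wkT x g)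
      (⇒E (∀E (⇒E (∧E₁ (ax-=⇒ f g)) p) x) e)

  ⟨,⟩-β : ∀ {γ α β} (F : Tm Γ (γ ⇒ α)) (G : Tm Γ (γ ⇒ β)) (x : Tm Γ γ) →
          Pf Γ Δ (⟨ F , G ⟩ · x ≐ con pair · (F · x) · (G · x))
  ⟨,⟩-β F G x =
    ≐-trans (ax-s _ G x)
      (·-congˡ (≐-trans (ax-s (con k · con pair) F x) (·-congˡ (ax-k (con pair) x))))

  fst-⟨,⟩ : ∀ {γ α β} (F : Tm Γ (γ ⇒ α)) (G : Tm Γ (γ ⇒ β)) (x : Tm Γ γ) →
            Pf Γ Δ (con fst · (⟨ F , G ⟩ · x) ≐ F · x)
  fst-⟨,⟩ F G x = ≐-trans (·-congʳ (⟨,⟩-β F G x)) (ax-fst _ _)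

  snd-⟨,⟩ : ∀ {γ α β} (F : Tm Γ (γ ⇒ α)) (G : Tm Γ (γ ⇒ β)) (x : Tm Γ γ) →
            Pf Γ Δ (con snd · (⟨ F , G ⟩ · x) ≐ G · x)
  snd-⟨,⟩ F G x = ≐-trans (·-congʳ (⟨,⟩-β F G x)) (ax-snd _ _)

-- The implicational forms are what make the recursion on types go through: the
-- hypotheses they discharge are weakened along with the context under ∀I.
⊢≐⇒≈ : ∀ σ {Γ Δ} (a b : Tm Γ σ) → Pf Γ Δ (a ≐ b ⇒' a ≈ₑ b)
⊢≐⇒≈ o       a b = ⇒I (≈o-intro hyp₀)
⊢≐⇒≈ (σ ⊗ τ) a b =
  ⇒I (≈⊗-intro (⇒E (⊢≐⇒≈ σ _ _) (·-congʳ hyp₀)) (⇒E (⊢≐⇒≈ τ _ _) (·-congʳ hyp₀)))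
⊢≐⇒≈ (σ ⇒ τ) a b = ⇒I (≈⇒-intro (∀I (⇒I (⇒E (⊢≐⇒≈ τ _ _) (·-congˡ hyp₁)))))

≐⇒≈ : ∀ {σ Γ Δ} {a b : Tm Γ σ} → Pf Γ Δ (a ≐ b) → Pf Γ Δ (a ≈ₑ b)
≐⇒≈ {σ} p = ⇒E (⊢≐⇒≈ σ _ _) p

⊢≈-resp-≐ : ∀ σ {Γ Δ} (a a' b b' : Tm Γ σ) →
            Pf Γ Δ (a ≐ a' ⇒' b ≐ b' ⇒' a ≈ₑ b ⇒' a' ≈ₑ b')
⊢≈-resp-≐ o a a' b b' =
  ⇒I (⇒I (⇒I (≈o-intro (≐-trans (≐-sym hyp₂) (≐-trans (≈o-elim hyp₀) hyp₁)))))
⊢≈-resp-≐ (σ ⊗ τ) a a' b b' = ⇒I (⇒I (⇒I (≈⊗-intro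
  (⇒E (⇒E (⇒E (⊢≈-resp-≐ σ _ _ _ _) (·-congʳ hyp₂)) (·-congʳ hyp₁)) (≈⊗-fst hyp₀))
  (⇒E (⇒E (⇒E (⊢≈-resp-≐ τ _ _ _ _) (·-congʳ hyp₂)) (·-congʳ hyp₁)) (≈⊗-snd hyp₀)))))
⊢≈-resp-≐ (σ ⇒ τ) a a' b b' = ⇒I (⇒I (⇒I (≈⇒-intro (∀I (⇒I
  (⇒E (⇒E (⇒E (⊢≈-resp-≐ τ _ _ _ _) (·-congˡ hyp₃)) (·-congˡ hyp₂)) (≈-app hyp₁ hyp₀)))))))

≈-resp-≐ : ∀ {σ Γ Δ} {a a' b b' : Tm Γ σ} →
           Pf Γ Δ (a ≐ a') → Pf Γ Δ (b ≐ b') → Pf Γ Δ (a ≈ₑ b) → Pf Γ Δ (a' ≈ₑ b')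
≈-resp-≐ {σ} p q r = ⇒E (⇒E (⇒E (⊢≈-resp-≐ σ _ _ _ _) p) q) r

module _ {γ α β : Ty} (f : Hom γ α) (g : Hom γ β) where
  ⟨,⟩⨾fst : (⟨ f , g ⟩ ⨾ con fst) ≈C f
  ⟨,⟩⨾fst = ≈⇒-intro (∀I (⇒I (≐⇒≈
    (≐-trans (⨾-β there ⟨ f , g ⟩ (con fst) v₀) (fst-⟨,⟩ _ _ v₀)))))

  ⟨,⟩⨾snd : (⟨ f , g ⟩ ⨾ con snd) ≈C g
  ⟨,⟩⨾snd = ≈⇒-intro (∀I (⇒I (≐⇒≈
    (≐-trans (⨾-β there ⟨ f , g ⟩ (con snd) v₀) (snd-⟨,⟩ _ _ v₀)))))

  -- Pf has no weakening, so closed theorems needed under ∀I enter as implications.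
  ⊢⟨,⟩-unique : (h : Hom γ (α ⊗ β)) →
                Thm ((h ⨾ con fst) ≈ₑ f ⇒' (h ⨾ con snd) ≈ₑ g ⇒' h ≈ₑ ⟨ f , g ⟩)
  ⊢⟨,⟩-unique h = ⇒I (⇒I (≈⇒-intro (∀I (⇒I (≈⊗-intro
    (≈-resp-≐ (⨾-β there h (con fst) v₀) (≐-sym (fst-⟨,⟩ _ _ v₀)) (≈-app hyp₂ hyp₀))
    (≈-resp-≐ (⨾-β there h (con snd) v₀) (≐-sym (snd-⟨,⟩ _ _ v₀)) (≈-app hyp₁ hyp₀)))))))

  ⟨,⟩-unique : (h : Hom γ (α ⊗ β)) →
               (h ⨾ con fst) ≈C f → (h ⨾ con snd) ≈C g → h ≈C ⟨ f , g ⟩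
  ⟨,⟩-unique h p q = ⇒E (⇒E (⊢⟨,⟩-unique h) p) q

module _ {α : Ty} where
  StrongAt : ∀ {β} → Tm (α ∷ α ∷ []) (α ⇒ β) → Fm (α ∷ α ∷ [])
  StrongAt u = Ext α v₁ ⇒' Ext α v₀ ⇒' v₁ ≈ₑ v₀ ⇒' u · v₁ ≈ₑ u · v₀

  -- Strong t unfolds to Thm (StrongFm t), so the two are used interchangeably.
  StrongFm : ∀ {β} → Hom α β → Fm []
  StrongFm t = ∀' α (∀' α (StrongAt (wkT (wkT t))))

  strong-at : ∀ {β} (f : Hom α β) {Δ : List (Fm (α ∷ α ∷ []))} →
              Pf (α ∷ α ∷ []) Δ (wkF (wkF (StrongFm f))) →
              Pf (α ∷ α ∷ []) Δ (StrongAt (wkT (wkT f)))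
  strong-at f {Δ} p =
    subst (λ u → Pf (α ∷ α ∷ []) Δ (StrongAt u)) instance≡ (∀E (∀E p v₁) v₀)
    where
    open ≡-Reasoning

    L : ∀ {Γ} → Ren (α ∷ α ∷ Γ) (α ∷ α ∷ α ∷ Γ)
    L = liftR (liftR there)

    L-wkT² : ∀ {Γ σ} (t : Tm Γ σ) → renT L (wkT (wkT t)) ≡ wkT (wkT (wkT t))
    L-wkT² t = trans (renT-liftR-wkT (liftR there) (wkT t)) (cong wkT (renT-liftR-wkT there t))

    instance≡ : subT (sub0 v₀) (subT (liftS (sub0 v₁)) (renT L (renT L (wkT (wkT f)))))
              ≡ wkT (wkT f)
    instance≡ = begin
      subT (sub0 v₀) (subT (liftS (sub0 v₁)) (renT L (renT L (wkT (wkT f)))))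
        ≡⟨ cong (λ u → subT (sub0 v₀) (subT (liftS (sub0 v₁)) (renT L u))) (L-wkT² f) ⟩
      subT (sub0 v₀) (subT (liftS (sub0 v₁)) (renT L (wkT (wkT (wkT f)))))
        ≡⟨ cong (λ u → subT (sub0 v₀) (subT (liftS (sub0 v₁)) u)) (L-wkT² (wkT f)) ⟩
      subT (sub0 v₀) (subT (liftS (sub0 v₁)) (wkT (wkT (wkT (wkT f)))))
        ≡⟨ cong (subT (sub0 v₀)) (subT-liftS-wkT (sub0 v₁) (wkT (wkT (wkT f)))) ⟩
      subT (sub0 v₀) (wkT (subT (sub0 v₁) (wkT (wkT (wkT f)))))
        ≡⟨ cong (λ u → subT (sub0 v₀) (wkT u)) (subT-sub0-wkT v₁ (wkT (wkT f))) ⟩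
      subT (sub0 v₀) (wkT (wkT (wkT f)))
        ≡⟨ subT-sub0-wkT v₀ (wkT (wkT f)) ⟩
      wkT (wkT f) ∎

fst-strong : ∀ {α β} → Strong (con (fst {α} {β}))
fst-strong = ∀I (∀I (⇒I (⇒I (⇒I (≈⊗-fst hyp₀)))))

snd-strong : ∀ {α β} → Strong (con (snd {α} {β}))
snd-strong = ∀I (∀I (⇒I (⇒I (⇒I (≈⊗-snd hyp₀)))))

⊢⟨,⟩-strong : ∀ {γ α β} (f : Hom γ α) (g : Hom γ β) →
              Thm (StrongFm f ⇒' StrongFm g ⇒' StrongFm ⟨ f , g ⟩)
⊢⟨,⟩-strong f g = ⇒I (⇒I (∀I (∀I (⇒I (⇒I (⇒I (≈⊗-intro
  (≈-resp-≐ (≐-sym (fst-⟨,⟩ _ _ _)) (≐-sym (fst-⟨,⟩ _ _ _))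
    (⇒E (⇒E (⇒E (strong-at f hyp₄) hyp₂) hyp₁) hyp₀))
  (≈-resp-≐ (≐-sym (snd-⟨,⟩ _ _ _)) (≐-sym (snd-⟨,⟩ _ _ _))
    (⇒E (⇒E (⇒E (strong-at g hyp₃) hyp₂) hyp₁) hyp₀)))))))))

⟨,⟩-strong : ∀ {γ α β} {f : Hom γ α} {g : Hom γ β} →
             Strong f → Strong g → Strong ⟨ f , g ⟩
⟨,⟩-strong {f = f} {g} p q = ⇒E (⇒E (⊢⟨,⟩-strong f g) p) q

isProductIn : (P : ∀ {α β} → Hom α β → Set) {α β : Ty} →
              P (con (fst {α} {β})) → P (con (snd {α} {β})) →
              (∀ {γ} {f : Hom γ α} {g : Hom γ β} → P f → P g → P ⟨ f , g ⟩) →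
              IsProductIn P α β
isProductIn P P-fst P-snd P-⟨,⟩ = record
  { fst-in    = P-fst
  ; snd-in    = P-snd
  ; universal = λ γ f g P-f P-g →
      ⟨ f , g ⟩ , P-⟨,⟩ P-f P-g , ⟨,⟩⨾fst f g , ⟨,⟩⨾snd f g , λ h _ → ⟨,⟩-unique f g h
  }

lemma3p1 : ∀ (α β : Ty) → IsProductC α β × IsProductS α β
lemma3p1 α β =
  isProductIn AllMorphisms tt tt (λ _ _ → tt) ,
  isProductIn Strong fst-strong snd-strong ⟨,⟩-strong
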